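{- Let $q$ be a prime power and let $a\geq2$ be an integer. Then \[ \varphi^{+}_{1,a}(q)\geq q^{\binom{a+1}{2}}\left(1-\frac{1}{q}+\frac{1}{q^2}-\frac{2}{q^{3}}\right). \]
   Context: For integers $b\ge a\ge0$, $\varphi^{+}_{a,b}(q)=\prod_{k=a}^{b}(q^k+(-1)^k)$. -}

module Defs where

open import Data.Nat using (ℕ; zero; suc; _≥_; _^_)
open import Data.Nat.Primality using (Prime)
open import Data.Integer as ℤ using (ℤ; +_; -[1+_])
open import Data.Product using (Σ; _×_)
open import Relation.Binary.PropositionalEquality using (_≡_)

IsPrimePower : ℕ → Set
IsPrimePower q = Σ ℕ λ p → Σ ℕ λ k → Prime p × k ≥ 1 × q ≡ p ^ k

negOnePow : ℕ → ℤ
negOnePow zero = + 1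
negOnePow (suc k) = ℤ.- (negOnePow k)

prodFrom : ℕ → ℕ → ℤ → ℤ
prodFrom a zero q = + 1
prodFrom a (suc n) q = ((q ℤ.^ a) ℤ.+ negOnePow a) ℤ.* prodFrom (suc a) n q

-- φ⁺_{a,b}(q) = ∏_{k=a}^{b} (q^k + (-1)^k)   (for b ≥ a; empty product if b < a)
φ⁺ : ℕ → ℕ → ℤ → ℤ
φ⁺ a b q = prodFrom a (suc b Data.Nat.∸ a) q

module Submission where

-- Dividing by q^(1+2+⋯+a), the product becomes ∏_{k=1}^{a} (1 + (-1)^k q^(-k)).
-- For q ≥ 2 a pair of factors starting at an even index, (1 + q^(-b))(1 - q^(-b-1)),
-- is at least 1, so a tail of the product starting at an even index is at least 1
-- and one starting at an odd index b is at least 1 - q^(-b). Keeping the first two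
-- factors and bounding the tail from k = 3, the product is at least
-- (1 - 1/q)(1 + 1/q²)(1 - 1/q³) = 1 - 1/q + 1/q² - 2/q³ + (q² - q + 1)/q⁶.

open import Defs
open import Algebra.Bundles using (CommutativeRing)
open import Algebra.Properties.CommutativeSemigroup as CommSemigroupProperties using ()
open import Data.Maybe using (nothing)
open import Data.Nat using (ℕ; zero; suc; _≥_; s≤s; z≤n; NonZero)
import Data.Nat as ℕ
import Data.Nat.Properties as ℕ
open import Data.Nat.Combinatorics using (_C_; nC1≡n; nCk+nC[k+1]≡[n+1]C[k+1])
open import Data.Nat.Primality using (prime⇒nonZero; prime⇒nonTrivial)
open import Data.Integer as ℤ using (ℤ; +_; +[1+_]; 0ℤ; 1ℤ; -1ℤ; +≤+)
import Data.Integer.Properties as ℤ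
import Data.Integer.Tactic.RingSolver as ℤ-Solver
open import Data.Product using (_,_)
open import Data.Rational as ℚ using (ℚ; _/_; 1ℚ; toℚᵘ)
import Data.Rational.Properties as ℚ
open import Data.Rational.Unnormalised as ℚᵘ using (mkℚᵘ; *≡*; *≤*; _≃_)
import Data.Rational.Unnormalised.Properties as ℚᵘ
open import Relation.Binary.PropositionalEquality
open import Tactic.RingSolver.Core.AlmostCommutativeRing using (AlmostCommutativeRing; fromCommutativeRing)
import Tactic.RingSolver as RingSolver

open CommSemigroupProperties ℕ.+-commutativeSemigroup using () renaming (x∙yz≈y∙xz to +-exchange)
open CommSemigroupProperties ℤ.*-commutativeSemigroup using () renaming (x∙yz≈y∙xz to *-exchange)
open CommSemigroupProperties (CommutativeRing.*-commutativeSemigroup ℚ.+-*-commutativeRing)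
  using () renaming (x∙yz≈y∙xz to ℚ-*-exchange)

sumFrom : ℕ → ℕ → ℕ
sumFrom b zero    = 0
sumFrom b (suc n) = b ℕ.+ sumFrom (suc b) n

sumFrom-suc : ∀ b n → sumFrom (suc b) n ≡ n ℕ.+ sumFrom b n
sumFrom-suc b zero    = refl
sumFrom-suc b (suc n) =
  cong suc (trans (cong (b ℕ.+_) (sumFrom-suc (suc b) n)) (+-exchange b n (sumFrom (suc b) n)))

sumFrom1≡[n+1]C2 : ∀ n → sumFrom 1 n ≡ (n ℕ.+ 1) C 2
sumFrom1≡[n+1]C2 zero    = refl
sumFrom1≡[n+1]C2 (suc n) = begin
  suc (sumFrom 2 n)                    ≡⟨ cong suc (sumFrom-suc 1 n) ⟩
  suc n ℕ.+ sumFrom 1 n                ≡⟨ cong₂ ℕ._+_ (ℕ.+-comm 1 n) (sumFrom1≡[n+1]C2 n) ⟩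
  (n ℕ.+ 1) ℕ.+ (n ℕ.+ 1) C 2          ≡⟨ cong (ℕ._+ (n ℕ.+ 1) C 2) (nC1≡n (n ℕ.+ 1)) ⟨
  (n ℕ.+ 1) C 1 ℕ.+ (n ℕ.+ 1) C 2      ≡⟨ nCk+nC[k+1]≡[n+1]C[k+1] (n ℕ.+ 1) 1 ⟩
  suc (n ℕ.+ 1) C 2                    ∎
  where open ≡-Reasoning

primePower⇒2≤ : ∀ {q} → IsPrimePower q → 2 ℕ.≤ q
primePower⇒2≤ (p , k , p-prime , k≥1 , refl) = begin
  2        ≤⟨ ℕ.nonTrivial⇒n>1 p {{prime⇒nonTrivial p-prime}} ⟩
  p        ≡⟨ ℕ.^-identityʳ p ⟨
  p ℕ.^ 1  ≤⟨ ℕ.^-monoʳ-≤ p {{prime⇒nonZero p-prime}} k≥1 ⟩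
  p ℕ.^ k  ∎
  where open ℕ.≤-Reasoning

pos-^ : ∀ m n → + (m ℕ.^ n) ≡ (+ m) ℤ.^ n
pos-^ m zero    = refl
pos-^ m (suc n) = trans (ℤ.pos-* m (m ℕ.^ n)) (cong (+ m ℤ.*_) (pos-^ m n))

≤-by-difference : ∀ {i j} d → j ℤ.- i ≡ d → 0ℤ ℤ.≤ d → i ℤ.≤ j
≤-by-difference d j-i≡d 0≤d = ℤ.0≤i-j⇒j≤i (subst (0ℤ ℤ.≤_) (sym j-i≡d) 0≤d)

1≤⇒0≤ : ∀ {i} → + 1 ℤ.≤ i → 0ℤ ℤ.≤ i
1≤⇒0≤ = ℤ.≤-trans (+≤+ z≤n)

1≤⇒0< : ∀ {i} → + 1 ℤ.≤ i → 0ℤ ℤ.< i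
1≤⇒0< = ℤ.<-≤-trans (ℤ.+<+ (s≤s z≤n))

1≤i*j : ∀ {i j} → + 1 ℤ.≤ i → + 1 ℤ.≤ j → + 1 ℤ.≤ i ℤ.* j
1≤i*j {i} {j} 1≤i 1≤j = begin
  + 1       ≤⟨ 1≤j ⟩
  j         ≡⟨ ℤ.*-identityˡ j ⟨
  + 1 ℤ.* j ≤⟨ ℤ.*-monoʳ-≤-nonNeg j {{ℤ.nonNegative (1≤⇒0≤ 1≤j)}} 1≤i ⟩
  i ℤ.* j   ∎
  where open ℤ.≤-Reasoning

1≤^ : ∀ {Q} → + 1 ℤ.≤ Q → ∀ n → + 1 ℤ.≤ Q ℤ.^ n
1≤^ 1≤Q zero    = ℤ.≤-refl
1≤^ 1≤Q (suc n) = 1≤i*j 1≤Q (1≤^ 1≤Q n)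

module _ {Q : ℤ} (2≤Q : + 2 ℤ.≤ Q) where

  open import Data.Integer using (_+_; _-_; _*_; _^_; _≤_)

  private
    1≤Q : + 1 ≤ Q
    1≤Q = ℤ.≤-trans (+≤+ (s≤s z≤n)) 2≤Q

    1≤Q-1 : + 1 ≤ Q - 1ℤ
    1≤Q-1 = ℤ.+-monoˡ-≤ -1ℤ 2≤Q

    0≤^ : ∀ n → 0ℤ ≤ Q ^ n
    0≤^ n = 1≤⇒0≤ (1≤^ 1≤Q n)

  QAA≤[A+1][QA-1] : ∀ {A} → + 1 ≤ A → Q * A * A ≤ (A + 1ℤ) * (Q * A - 1ℤ)
  QAA≤[A+1][QA-1] {A} 1≤A =
    ≤-by-difference (A * (Q - 1ℤ) - 1ℤ) (difference Q A) (ℤ.i≤j⇒0≤j-i (1≤i*j 1≤A 1≤Q-1))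
    where
    difference : ∀ Q A → (A + 1ℤ) * (Q * A - 1ℤ) - Q * A * A ≡ A * (Q - 1ℤ) - 1ℤ
    difference = ℤ-Solver.solve-∀

  Q³T≤[Q-1][Q²+1][Q³-1] :
    Q * Q * Q * (Q * Q * Q - Q * Q + Q - + 2) ≤ (Q - 1ℤ) * (Q * Q + 1ℤ) * (Q * Q * Q - 1ℤ)
  Q³T≤[Q-1][Q²+1][Q³-1] =
    ≤-by-difference (Q * (Q - 1ℤ) + 1ℤ) (difference Q)
      (ℤ.≤-trans (1≤⇒0≤ (1≤i*j 1≤Q 1≤Q-1)) (ℤ.i≤i+j _ 1ℤ))
    where
    difference : ∀ Q → (Q - 1ℤ) * (Q * Q + 1ℤ) * (Q * Q * Q - 1ℤ)
                         - Q * Q * Q * (Q * Q * Q - Q * Q + Q - + 2)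
                       ≡ Q * (Q - 1ℤ) + 1ℤ
    difference = ℤ-Solver.solve-∀

  -- The tail bounds ≥ 1 (b even) and ≥ 1 - Q^(-b) (b odd) with denominators cleared.
  -- Parity is given as the value of negOnePow b; as negOnePow (suc b) = - negOnePow b,
  -- each lemma passes the other its hypothesis by cong -_.
  mutual
    prodFrom-even-lower : ∀ b → negOnePow b ≡ 1ℤ → ∀ n → Q ^ sumFrom b n ≤ prodFrom b n Q
    prodFrom-even-lower b even zero    = ℤ.≤-refl
    prodFrom-even-lower b even (suc n) =
      ℤ.*-cancelˡ-≤-pos _ _ (Q * A) {{ℤ.positive (1≤⇒0< (1≤^ 1≤Q (suc b)))}} (begin
        Q * A * Q ^ (b ℕ.+ S)           ≡⟨ cong (Q * A *_) (ℤ.^-distribˡ-+-* Q b S) ⟩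
        Q * A * (A * E)                 ≡⟨ ℤ.*-assoc (Q * A) A E ⟨
        Q * A * A * E                   ≤⟨ ℤ.*-monoʳ-≤-nonNeg E {{ℤ.nonNegative (0≤^ S)}}
                                             (QAA≤[A+1][QA-1] (1≤^ 1≤Q b)) ⟩
        (A + 1ℤ) * (Q * A - 1ℤ) * E     ≡⟨ ℤ.*-assoc (A + 1ℤ) _ E ⟩
        (A + 1ℤ) * ((Q * A - 1ℤ) * E)   ≤⟨ ℤ.*-monoˡ-≤-nonNeg (A + 1ℤ) {{ℤ.nonNegative 0≤A+1}}
                                             (prodFrom-odd-lower (suc b) (cong ℤ.-_ even) n) ⟩
        (A + 1ℤ) * (Q * A * P)          ≡⟨ *-exchange (A + 1ℤ) (Q * A) P ⟩
        Q * A * ((A + 1ℤ) * P)          ≡⟨ cong (λ c → Q * A * ((A + c) * P)) even ⟨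
        Q * A * ((A + negOnePow b) * P) ∎)
      where
      open ℤ.≤-Reasoning
      A = Q ^ b
      S = sumFrom (suc b) n
      E = Q ^ S
      P = prodFrom (suc b) n Q
      0≤A+1 : 0ℤ ≤ A + 1ℤ
      0≤A+1 = ℤ.≤-trans (0≤^ b) (ℤ.i≤i+j A 1ℤ)

    prodFrom-odd-lower : ∀ b → negOnePow b ≡ -1ℤ → ∀ n →
                         (Q ^ b - 1ℤ) * Q ^ sumFrom b n ≤ Q ^ b * prodFrom b n Q
    prodFrom-odd-lower b odd zero    = ℤ.*-monoʳ-≤-nonNeg 1ℤ (ℤ.i-j≤i (Q ^ b) 1ℤ)
    prodFrom-odd-lower b odd (suc n) = begin
      (A - 1ℤ) * Q ^ (b ℕ.+ S)     ≡⟨ cong ((A - 1ℤ) *_) (ℤ.^-distribˡ-+-* Q b S) ⟩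
      (A - 1ℤ) * (A * E)           ≡⟨ *-exchange (A - 1ℤ) A E ⟩
      A * ((A - 1ℤ) * E)           ≤⟨ ℤ.*-monoˡ-≤-nonNeg A {{ℤ.nonNegative (0≤^ b)}}
                                       (ℤ.*-monoˡ-≤-nonNeg (A - 1ℤ) {{ℤ.nonNegative 0≤A-1}}
                                         (prodFrom-even-lower (suc b) (cong ℤ.-_ odd) n)) ⟩
      A * ((A - 1ℤ) * P)           ≡⟨ cong (λ c → A * ((A + c) * P)) odd ⟨
      A * ((A + negOnePow b) * P)  ∎
      where
      open ℤ.≤-Reasoning
      A = Q ^ b
      S = sumFrom (suc b) n
      E = Q ^ S
      P = prodFrom (suc b) n Q
      0≤A-1 : 0ℤ ≤ A - 1ℤ
      0≤A-1 = ℤ.i≤j⇒0≤j-i (1≤^ 1≤Q b)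

  φ⁺-lower : ∀ a → a ≥ 2 →
             Q ^ sumFrom 1 a * (Q * Q * Q - Q * Q + Q - + 2) ≤ Q * Q * Q * φ⁺ 1 a Q
  φ⁺-lower (suc (suc n)) (s≤s (s≤s z≤n)) = begin
    Q * (Q * (Q * E)) * T
      ≡⟨ regroup₁ Q E ⟩
    E * (Q * Q * Q * T)
      ≤⟨ ℤ.*-monoˡ-≤-nonNeg E {{ℤ.nonNegative (0≤^ S)}} Q³T≤[Q-1][Q²+1][Q³-1] ⟩
    E * ((Q - 1ℤ) * (Q * Q + 1ℤ) * (Q * Q * Q - 1ℤ))
      ≡⟨ regroup₂ Q E ⟩
    (Q - 1ℤ) * (Q * Q + 1ℤ) * ((Q ^ 3 - 1ℤ) * E)
      ≤⟨ ℤ.*-monoˡ-≤-nonNeg ((Q - 1ℤ) * (Q * Q + 1ℤ)) {{ℤ.nonNegative 0≤[Q-1][Q²+1]}}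
           (prodFrom-odd-lower 3 refl n) ⟩
    (Q - 1ℤ) * (Q * Q + 1ℤ) * (Q ^ 3 * P)
      ≡⟨ regroup₃ Q P ⟩
    Q * Q * Q * ((Q ^ 1 + negOnePow 1) * ((Q ^ 2 + negOnePow 2) * P))
      ∎
    where
    open ℤ.≤-Reasoning
    S = sumFrom 3 n
    E = Q ^ S
    P = prodFrom 3 n Q
    T = Q * Q * Q - Q * Q + Q - + 2
    0≤[Q-1][Q²+1] : 0ℤ ≤ (Q - 1ℤ) * (Q * Q + 1ℤ)
    0≤[Q-1][Q²+1] = 1≤⇒0≤ (1≤i*j 1≤Q-1 (ℤ.≤-trans (1≤i*j 1≤Q 1≤Q) (ℤ.i≤i+j _ 1ℤ)))
    regroup₁ : ∀ Q E → Q * (Q * (Q * E)) * (Q * Q * Q - Q * Q + Q - + 2)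
                       ≡ E * (Q * Q * Q * (Q * Q * Q - Q * Q + Q - + 2))
    regroup₁ = ℤ-Solver.solve-∀
    regroup₂ : ∀ Q E → E * ((Q - 1ℤ) * (Q * Q + 1ℤ) * (Q * Q * Q - 1ℤ))
                       ≡ (Q - 1ℤ) * (Q * Q + 1ℤ) * ((Q * (Q * (Q * 1ℤ)) - 1ℤ) * E)
    regroup₂ = ℤ-Solver.solve-∀
    regroup₃ : ∀ Q P → (Q - 1ℤ) * (Q * Q + 1ℤ) * (Q * (Q * (Q * 1ℤ)) * P)
                       ≡ Q * Q * Q * ((Q * 1ℤ + -1ℤ) * ((Q * (Q * 1ℤ) + 1ℤ) * P))
    regroup₃ = ℤ-Solver.solve-∀

open import Data.Nat using (_^_)
open import Data.Rational using (_+_; _-_; _*_; _≤_)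

ι : ℤ → ℚ
ι i = i / 1

toℚᵘ-ι : ∀ i → toℚᵘ (ι i) ≃ mkℚᵘ i 0
toℚᵘ-ι i = ℚ.toℚᵘ-fromℚᵘ (mkℚᵘ i 0)

ι-homo-* : ∀ i j → ι (i ℤ.* j) ≡ ι i * ι j
ι-homo-* i j = ℚ.toℚᵘ-injective (begin
  toℚᵘ (ι (i ℤ.* j))          ≈⟨ toℚᵘ-ι (i ℤ.* j) ⟩
  mkℚᵘ i 0 ℚᵘ.* mkℚᵘ j 0      ≈⟨ ℚᵘ.*-cong (toℚᵘ-ι i) (toℚᵘ-ι j) ⟨
  toℚᵘ (ι i) ℚᵘ.* toℚᵘ (ι j)  ≈⟨ ℚ.toℚᵘ-homo-* (ι i) (ι j) ⟨
  toℚᵘ (ι i * ι j)            ∎)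
  where open ℚᵘ.≃-Reasoning

ι-homo-+ : ∀ i j → ι (i ℤ.+ j) ≡ ι i + ι j
ι-homo-+ i j = ℚ.toℚᵘ-injective (begin
  toℚᵘ (ι (i ℤ.+ j))          ≈⟨ toℚᵘ-ι (i ℤ.+ j) ⟩
  mkℚᵘ (i ℤ.+ j) 0            ≈⟨ *≡* (cross-multiplied i j) ⟩
  mkℚᵘ i 0 ℚᵘ.+ mkℚᵘ j 0      ≈⟨ ℚᵘ.+-cong (toℚᵘ-ι i) (toℚᵘ-ι j) ⟨
  toℚᵘ (ι i) ℚᵘ.+ toℚᵘ (ι j)  ≈⟨ ℚ.toℚᵘ-homo-+ (ι i) (ι j) ⟨
  toℚᵘ (ι i + ι j)            ∎)
  where
  open ℚᵘ.≃-Reasoning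
  cross-multiplied : ∀ i j → (i ℤ.+ j) ℤ.* + 1 ≡ (i ℤ.* + 1 ℤ.+ j ℤ.* + 1) ℤ.* + 1
  cross-multiplied = ℤ-Solver.solve-∀

ι-homo‿- : ∀ i → ι (ℤ.- i) ≡ ℚ.- ι i
ι-homo‿- i = ℚ.toℚᵘ-injective (begin
  toℚᵘ (ι (ℤ.- i))  ≈⟨ toℚᵘ-ι (ℤ.- i) ⟩
  ℚᵘ.- mkℚᵘ i 0     ≈⟨ ℚᵘ.-‿cong (toℚᵘ-ι i) ⟨
  ℚᵘ.- toℚᵘ (ι i)   ≈⟨ ℚ.toℚᵘ-homo‿- (ι i) ⟨
  toℚᵘ (ℚ.- ι i)    ∎)
  where open ℚᵘ.≃-Reasoning

ι-homo-- : ∀ i j → ι (i ℤ.- j) ≡ ι i - ι j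
ι-homo-- i j = trans (ι-homo-+ i (ℤ.- j)) (cong (_+_ (ι i)) (ι-homo‿- j))

ι-mono-≤ : ∀ {i j} → i ℤ.≤ j → ι i ℚ.≤ ι j
ι-mono-≤ {i} {j} i≤j = ℚ.toℚᵘ-cancel-≤ (begin
  toℚᵘ (ι i)  ≃⟨ toℚᵘ-ι i ⟩
  mkℚᵘ i 0    ≤⟨ *≤* (ℤ.*-monoʳ-≤-nonNeg (+ 1) i≤j) ⟩
  mkℚᵘ j 0    ≃⟨ toℚᵘ-ι j ⟨
  toℚᵘ (ι j)  ∎)
  where open ℚᵘ.≤-Reasoning

ι-positive : ∀ i .{{_ : ℤ.Positive i}} → ℚ.Positive (ι i)
ι-positive +[1+ n ] = ℚ.normalize-pos (suc n) 1

ι[n]*1/n≡1 : ∀ n .{{_ : NonZero n}} → ι (+ n) * (+ 1 / n) ≡ 1ℚ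
ι[n]*1/n≡1 (suc m) = ℚ.toℚᵘ-injective (begin
  toℚᵘ (ι (+ suc m) * (+ 1 / suc m))            ≈⟨ ℚ.toℚᵘ-homo-* (ι (+ suc m)) (+ 1 / suc m) ⟩
  toℚᵘ (ι (+ suc m)) ℚᵘ.* toℚᵘ (+ 1 / suc m)    ≈⟨ ℚᵘ.*-cong (toℚᵘ-ι (+ suc m))
                                                               (ℚ.toℚᵘ-fromℚᵘ (mkℚᵘ (+ 1) m)) ⟩
  mkℚᵘ (+ suc m) 0 ℚᵘ.* mkℚᵘ (+ 1) m            ≈⟨ ℚᵘ.*-inverseʳ (mkℚᵘ (+ suc m) 0) ⟩
  ℚᵘ.1ℚᵘ                                        ∎)
  where open ℚᵘ.≃-Reasoning

ℚ-ring : AlmostCommutativeRing _ _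
ℚ-ring = fromCommutativeRing ℚ.+-*-commutativeRing (λ _ → nothing)

ι-cube : ∀ Q → ι (Q ℤ.* Q ℤ.* Q) ≡ ι Q * ι Q * ι Q
ι-cube Q = trans (ι-homo-* (Q ℤ.* Q) Q) (cong (_* ι Q) (ι-homo-* Q Q))

ι[Q³-Q²+Q-2] : ∀ Q → ι (Q ℤ.* Q ℤ.* Q ℤ.- Q ℤ.* Q ℤ.+ Q ℤ.- + 2)
                     ≡ ι Q * ι Q * ι Q - ι Q * ι Q + ι Q - + 2 / 1
ι[Q³-Q²+Q-2] Q = begin
  ι (Q³ ℤ.- Q² ℤ.+ Q ℤ.- + 2)  ≡⟨ ι-homo-- (Q³ ℤ.- Q² ℤ.+ Q) (+ 2) ⟩
  ι (Q³ ℤ.- Q² ℤ.+ Q) - two    ≡⟨ cong (_- two) (ι-homo-+ (Q³ ℤ.- Q²) Q) ⟩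
  ι (Q³ ℤ.- Q²) + u - two      ≡⟨ cong (λ x → x + u - two) (ι-homo-- Q³ Q²) ⟩
  ι Q³ - ι Q² + u - two        ≡⟨ cong₂ (λ x y → x - y + u - two) (ι-cube Q) (ι-homo-* Q Q) ⟩
  u * u * u - u * u + u - two  ∎
  where
  open ≡-Reasoning
  u = ι Q
  two = + 2 / 1
  Q² = Q ℤ.* Q
  Q³ = Q² ℤ.* Q

u³[1-r+r²-2r³]≡u³-u²+u-2 : ∀ u {r} → u * r ≡ 1ℚ →
  u * u * u * (((1ℚ - r) + r * r) - (+ 2 / 1) * (r * (r * r))) ≡ u * u * u - u * u + u - + 2 / 1
u³[1-r+r²-2r³]≡u³-u²+u-2 u {r} ur≡1 = begin
  u * u * u * (((1ℚ - r) + r * r) - two * (r * (r * r)))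
    ≡⟨ expand u r ⟩
  u * u * u - u * u * (u * r) + u * ((u * r) * (u * r)) - two * ((u * r) * ((u * r) * (u * r)))
    ≡⟨ cong (λ w → u * u * u - u * u * w + u * (w * w) - two * (w * (w * w))) ur≡1 ⟩
  u * u * u - u * u * 1ℚ + u * (1ℚ * 1ℚ) - two * (1ℚ * (1ℚ * 1ℚ))
    ≡⟨ simplify u ⟩
  u * u * u - u * u + u - two
    ∎
  where
  open ≡-Reasoning
  two = + 2 / 1
  expand : ∀ u r → u * u * u * (((1ℚ - r) + r * r) - (+ 2 / 1) * (r * (r * r)))
                   ≡ u * u * u - u * u * (u * r) + u * ((u * r) * (u * r))
                     - (+ 2 / 1) * ((u * r) * ((u * r) * (u * r)))
  expand = RingSolver.solve-∀ ℚ-ring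
  simplify : ∀ u → u * u * u - u * u * 1ℚ + u * (1ℚ * 1ℚ) - (+ 2 / 1) * (1ℚ * (1ℚ * 1ℚ))
                   ≡ u * u * u - u * u + u - + 2 / 1
  simplify = RingSolver.solve-∀ ℚ-ring

lemma2p13 : (q : ℕ) .{{_ : NonZero q}} → IsPrimePower q → (a : ℕ) → a ≥ 2 →
    (+ (q ^ ((a Data.Nat.+ 1) C 2)) / 1) * (((1ℚ - (+ 1 / q)) + ((+ 1 / q) * (+ 1 / q))) - ((+ 2 / 1) * ((+ 1 / q) * ((+ 1 / q) * (+ 1 / q)))))
    ≤ (φ⁺ 1 a (+ q) / 1)
lemma2p13 q q-primePower a a≥2 =
  ℚ.*-cancelˡ-≤-pos (ι Q³) {{ι-positive Q³ {{ℤ.positive (1≤⇒0< 1≤Q³)}}}} (begin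
    ι Q³ * (X * s)                 ≡⟨ ℚ-*-exchange (ι Q³) X s ⟩
    X * (ι Q³ * s)                 ≡⟨ cong₂ _*_ X≡ι[Q^N] ι[Q³]*s≡ι[T] ⟩
    ι (Q ℤ.^ N) * ι T              ≡⟨ ι-homo-* (Q ℤ.^ N) T ⟨
    ι (Q ℤ.^ N ℤ.* T)              ≤⟨ ι-mono-≤ (φ⁺-lower 2≤Q a a≥2) ⟩
    ι (Q³ ℤ.* φ⁺ 1 a Q)            ≡⟨ ι-homo-* Q³ (φ⁺ 1 a Q) ⟩
    ι Q³ * (φ⁺ 1 a (+ q) / 1)      ∎)
  where
  open ℚ.≤-Reasoning
  Q = + q
  Q³ = Q ℤ.* Q ℤ.* Q
  T = Q³ ℤ.- Q ℤ.* Q ℤ.+ Q ℤ.- + 2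
  N = sumFrom 1 a
  2≤Q : + 2 ℤ.≤ Q
  2≤Q = +≤+ (primePower⇒2≤ q-primePower)
  1≤Q : + 1 ℤ.≤ Q
  1≤Q = +≤+ (ℕ.<⇒≤ (primePower⇒2≤ q-primePower))
  1≤Q³ : + 1 ℤ.≤ Q³
  1≤Q³ = 1≤i*j (1≤i*j 1≤Q 1≤Q) 1≤Q
  X = + (q ^ ((a Data.Nat.+ 1) C 2)) / 1
  s = ((1ℚ - (+ 1 / q)) + ((+ 1 / q) * (+ 1 / q))) - ((+ 2 / 1) * ((+ 1 / q) * ((+ 1 / q) * (+ 1 / q))))
  ι[Q³]*s≡ι[T] : ι Q³ * s ≡ ι T
  ι[Q³]*s≡ι[T] = trans (cong (_* s) (ι-cube Q))
                       (trans (u³[1-r+r²-2r³]≡u³-u²+u-2 (ι Q) (ι[n]*1/n≡1 q)) (sym (ι[Q³-Q²+Q-2] Q)))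
  X≡ι[Q^N] : X ≡ ι (Q ℤ.^ N)
  X≡ι[Q^N] = cong ι (trans (cong (λ n → + (q ^ n)) (sym (sumFrom1≡[n+1]C2 a))) (pos-^ q N))
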